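{- The head reduction $\to_h$ on addressing machines satisfies: (i) determinism: if $M\to_h N_1$ and $M\to_h N_2$ then $N_1=N_2$; (ii) closure under application: for all $a\in\mathbb{A}$, if $M\to_h N$ then $M@[a]\to_h N@[a]$.
   Context: Fix a countable set $\mathbb{A}$ of addresses and a symbol $\varnothing\notin\mathbb{A}$; $\mathbb{A}_\varnothing=\mathbb{A}\cup\{\varnothing\}$. A tape is a finite list of elements of $\mathbb{A}$; $a::T$ has head $a$ and tail $T$, $T@T'$ is concatenation. A program is a finite list of instructions generated by $P::=\mathtt{Load}\ i;P\mid A$, $A::=\mathtt{App}(i,j,k);A\mid C$, $C::=\mathtt{Call}\ i\mid\varepsilon$ ($i,j,k\in\mathbb{N}$). For $r\in\mathbb{N}$, $I\subseteq\{0,\dots,r-1\}$, $I\models^r P$ is the least relation such that: $I\models^r\varepsilon$; $I\models^r\mathtt{Call}\ i$ if $i\in I$; $I\models^r\mathtt{App}(i,j,k);A$ if $i,j\in I$ and either ($k<r$ and $I\cup\{k\}\models^r A$) or ($k\ge r$ and $I\models^r A$); $I\models^r\mathtt{Load}\ i;P$ if either ($i<r$ and $I\cup\{i\}\models^r P$) or ($i\ge r$ and $I\models^r P$). An addressing machine is $M=\langle R_0,\dots,R_{r-1},P,T\rangle$ with registers in $\mathbb{A}_\varnothing$, $P$ valid w.r.t. the registers ($\{i<r\mid R_i\ne\varnothing\}\models^r P$), and a tape $T$; $\mathcal{M}$ is the set of all of them. $\vec R[R_i:=a]$ replaces $R_i$ by $a$ if $i<r$, is $\vec R$ if $i\ge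 r$. Fix a bijection $\#:\mathcal{M}\to\mathbb{A}$ with inverse $\#^{ -1}$; $M@T'=\langle M.\vec R,M.P,M.T@T'\rangle$; $a\cdot b=\#(\#^{ -1}(a)@[b])$. Head reduction $\to_h$ is the least relation with: $\langle\vec R,\mathtt{Load}\ i;P,a::T\rangle\to_h\langle\vec R[R_i:=a],P,T\rangle$, $\langle\vec R,\mathtt{App}(i,j,k);P,T\rangle\to_h\langle\vec R[R_k:=R_i\cdot R_j],P,T\rangle$, $\langle\vec R,\mathtt{Call}\ i,T\rangle\to_h\#^{ -1}(R_i)@T$. -}

module Defs where

open import Data.Nat using (ℕ; zero; suc; _<_; _≥_; z≤n; s≤s)
open import Data.Maybe using (Maybe; just; nothing)
open import Data.List using (List; []; _∷_; _++_; [_])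
open import Data.Vec using (Vec; []; _∷_)
open import Data.Product using (∃-syntax; _,_)
open import Data.Sum using (_⊎_; inj₁; inj₂)
open import Relation.Binary.PropositionalEquality using (_≡_; refl)
open import Function.Bundles using (_↔_; Inverse)

data CProg : Set where
  call : ℕ → CProg
  ε    : CProg

data AProg : Set where
  app : ℕ → ℕ → ℕ → AProg → AProg
  cp  : CProg → AProg

data Prog : Set where
  load : ℕ → Prog → Prog
  ap   : AProg → Prog

Pred : Set₁
Pred = ℕ → Set

_∪｛_｝ : Pred → ℕ → Pred
(I ∪｛ k ｝) n = n ≡ k ⊎ I n

_⊆_ : Pred → Pred → Set
I ⊆ J = ∀ {n} → I n → J n

data ValidC (r : ℕ) : Pred → CProg → Set₁ where
  vε    : ∀ {I} → ValidC r I ε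
  vcall : ∀ {I i} → I i → ValidC r I (call i)

data ValidA (r : ℕ) : Pred → AProg → Set₁ where
  vcp   : ∀ {I C} → ValidC r I C → ValidA r I (cp C)
  vapp< : ∀ {I i j k A} → I i → I j → k < r → ValidA r (I ∪｛ k ｝) A →
          ValidA r I (app i j k A)
  vapp≥ : ∀ {I i j k A} → I i → I j → k ≥ r → ValidA r I A →
          ValidA r I (app i j k A)

data ValidP (r : ℕ) : Pred → Prog → Set₁ where
  vap    : ∀ {I A} → ValidA r I A → ValidP r I (ap A)
  vload< : ∀ {I i P} → i < r → ValidP r (I ∪｛ i ｝) P → ValidP r I (load i P)
  vload≥ : ∀ {I i P} → i ≥ r → ValidP r I P → ValidP r I (load i P)

-- Registers: A_∅ = Maybe A (nothing = ∅).  Lookup / update by a natural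
-- number; update with index ≥ r leaves the registers unchanged.
module _ {A : Set} where
  lookupR : ∀ {r} → Vec (Maybe A) r → ℕ → Maybe A
  lookupR []       _       = nothing
  lookupR (x ∷ xs) zero    = x
  lookupR (x ∷ xs) (suc n) = lookupR xs n

  _[_≔_] : ∀ {r} → Vec (Maybe A) r → ℕ → Maybe A → Vec (Maybe A) r
  []       [ _     ≔ v ] = []
  (x ∷ xs) [ zero  ≔ v ] = v ∷ xs
  (x ∷ xs) [ suc n ≔ v ] = x ∷ (xs [ n ≔ v ])

  Filled : ∀ {r} → Vec (Maybe A) r → Pred
  Filled R n = ∃[ x ] lookupR R n ≡ just x

-- Addressing machines; the validity proof is an irrelevant field, so two
-- machines are equal iff registers, program and tape are equal.
record Machine (A : Set) : Set₁ where
  constructor ⟨_,_,_⟩[_]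
  field
    {r}    : ℕ
    R      : Vec (Maybe A) r
    P      : Prog
    T      : List A
    .valid : ValidP r (Filled R) P
open Machine public

_＠_ : {A : Set} → Machine A → List A → Machine A
⟨ R , P , T ⟩[ v ] ＠ T' = ⟨ R , P , T ++ T' ⟩[ v ]

module _ {A : Set} where
  fill-keep : ∀ {r} (R : Vec (Maybe A) r) i a {n} → Filled R n → Filled (R [ i ≔ just a ]) n
  fill-keep []       i       a {n}     ()
  fill-keep (x ∷ R)  zero    a {zero}  _ = a , refl
  fill-keep (x ∷ R)  zero    a {suc n} f = f
  fill-keep (x ∷ R)  (suc i) a {zero}  f = f
  fill-keep (x ∷ R)  (suc i) a {suc n} f = fill-keep R i a f

  fill-new : ∀ {r} (R : Vec (Maybe A) r) i a → i < r → Filled (R [ i ≔ just a ]) i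
  fill-new (x ∷ R) zero    a _         = a , refl
  fill-new (x ∷ R) (suc i) a (s≤s i<r) = fill-new R i a i<r

  ∪-sub : ∀ {r} (R : Vec (Maybe A) r) {I} i a → i < r → I ⊆ Filled R →
          (I ∪｛ i ｝) ⊆ Filled (R [ i ≔ just a ])
  ∪-sub R i a i<r s (inj₁ refl) = fill-new R i a i<r
  ∪-sub R i a i<r s (inj₂ p)    = fill-keep R i a (s p)

  sub-upd : ∀ {r} (R : Vec (Maybe A) r) {I} i a → I ⊆ Filled R →
            I ⊆ Filled (R [ i ≔ just a ])
  sub-upd R i a s p = fill-keep R i a (s p)

monoC : ∀ {r I J C} → I ⊆ J → ValidC r I C → ValidC r J C
monoC s vε        = vε
monoC s (vcall p) = vcall (s p)

monoA : ∀ {r I J A} → I ⊆ J → ValidA r I A → ValidA r J A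
monoA s (vcp v) = vcp (monoC s v)
monoA s (vapp< p q k v) = vapp< (s p) (s q) k (monoA (λ { (inj₁ e) → inj₁ e ; (inj₂ x) → inj₂ (s x) }) v)
monoA s (vapp≥ p q k v) = vapp≥ (s p) (s q) k (monoA s v)

monoP : ∀ {r I J P} → I ⊆ J → ValidP r I P → ValidP r J P
monoP s (vap v) = vap (monoA s v)
monoP s (vload< i v) = vload< i (monoP (λ { (inj₁ e) → inj₁ e ; (inj₂ x) → inj₂ (s x) }) v)
monoP s (vload≥ i v) = vload≥ i (monoP s v)

module _ {A : Set} where
  load-valid : ∀ {r} (R : Vec (Maybe A) r) i P a →
               ValidP r (Filled R) (load i P) → ValidP r (Filled (R [ i ≔ just a ])) P
  load-valid R i P a (vload< i<r v) = monoP (∪-sub R i a i<r (λ p → p)) v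
  load-valid R i P a (vload≥ _ v)   = monoP (sub-upd R i a (λ p → p)) v

  app-valid : ∀ {r} (R : Vec (Maybe A) r) i j k A' c →
              ValidP r (Filled R) (ap (app i j k A')) →
              ValidP r (Filled (R [ k ≔ just c ])) (ap A')
  app-valid R i j k A' c (vap (vapp< _ _ k<r v)) = vap (monoA (∪-sub R k c k<r (λ p → p)) v)
  app-valid R i j k A' c (vap (vapp≥ _ _ _ v))   = vap (monoA (sub-upd R k c (λ p → p)) v)

module Head {A : Set} (# : Machine A ↔ A) where
  open Inverse #

  #⁻¹ : A → Machine A
  #⁻¹ = from

  _·_ : A → A → A
  a · b = to (#⁻¹ a ＠ [ b ])

  data _→h_ : Machine A → Machine A → Set₁ where
    hload : ∀ {r} {R : Vec (Maybe A) r} {i P a T} .(v : ValidP r (Filled R) (load i P)) →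
            ⟨ R , load i P , a ∷ T ⟩[ v ] →h ⟨ R [ i ≔ just a ] , P , T ⟩[ load-valid R i P a v ]
    happ  : ∀ {r} {R : Vec (Maybe A) r} {i j k A' T x y}
            .(v : ValidP r (Filled R) (ap (app i j k A'))) →
            lookupR R i ≡ just x → lookupR R j ≡ just y →
            ⟨ R , ap (app i j k A') , T ⟩[ v ] →h
            ⟨ R [ k ≔ just (x · y) ] , ap A' , T ⟩[ app-valid R i j k A' (x · y) v ]
    hcall : ∀ {r} {R : Vec (Maybe A) r} {i T x}
            .(v : ValidP r (Filled R) (ap (cp (call i)))) →
            lookupR R i ≡ just x →
            ⟨ R , ap (cp (call i)) , T ⟩[ v ] →h (#⁻¹ x ＠ T)

{-# OPTIONS --safe #-}
module Submission where

open import Defs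
open import Data.Nat using (ℕ)
open import Data.List using (List; [_]; _++_)
open import Data.List.Properties using (++-assoc)
open import Data.Maybe.Properties using (just-injective)
open import Data.Product using (_×_; _,_)
open import Function.Bundles using (_↔_; _↣_)
open import Relation.Binary.PropositionalEquality using (_≡_; refl; trans; sym; subst)

＠-++ : {A : Set} (M : Machine A) (T T' : List A) → (M ＠ T) ＠ T' ≡ M ＠ (T ++ T')
＠-++ ⟨ R , P , T₀ ⟩[ v ] T T' rewrite ++-assoc T₀ T T' = refl

module _ {A : Set} (# : Machine A ↔ A) where
  open Head #

  →h-deterministic : ∀ {M N₁ N₂ : Machine A} → M →h N₁ → M →h N₂ → N₁ ≡ N₂
  →h-deterministic (hload _) (hload _) = refl
  →h-deterministic (happ _ Ri Rj) (happ _ Ri′ Rj′)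
    with just-injective (trans (sym Ri) Ri′) | just-injective (trans (sym Rj) Rj′)
  ... | refl | refl = refl
  →h-deterministic (hcall _ Ri) (hcall _ Ri′) with just-injective (trans (sym Ri) Ri′)
  ... | refl = refl

  →h-＠ : ∀ (T' : List A) {M N : Machine A} → M →h N → (M ＠ T') →h (N ＠ T')
  →h-＠ T' (hload v) = hload v
  →h-＠ T' (happ v Ri Rj) = happ v Ri Rj
  →h-＠ T' (hcall {R = R} {i = i} {T = T} {x = x} v Ri) =
    subst (⟨ R , ap (cp (call i)) , T ++ T' ⟩[ v ] →h_) (sym (＠-++ (#⁻¹ x) T T'))
          (hcall v Ri)

lemma2p12 : {A : Set} → (countable : A ↣ ℕ) → (# : Machine A ↔ A) →
    (∀ {M N₁ N₂ : Machine A} → Head._→h_ # M N₁ → Head._→h_ # M N₂ → N₁ ≡ N₂)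
    × (∀ (a : A) {M N : Machine A} → Head._→h_ # M N → Head._→h_ # (M ＠ [ a ]) (N ＠ [ a ]))
lemma2p12 _ # = →h-deterministic # , λ a → →h-＠ # [ a ]
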